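{- A nontrivial simple graph $G$ admits an orientation $D$ such that $\gamma_{oso}(D)=n$, where $n$ is the order of $G$, if and only if $G$ is bipartite.
   Context: An orientation of a simple graph $G$ is a digraph obtained by replacing each edge by exactly one of its two possible arcs. For a digraph $D=(V,A)$, a set $S\subseteq V$ is out-dominating if every $v\in V\setminus S$ has an in-neighbor in $S$ (i.e. some $u\in S$ with $uv\in A$). $S$ is an out-secure out-dominating set (OSODS) if $S$ is out-dominating and for every $v\in V\setminus S$ there is $u\in S$ with $uv\in A$ such that $(S\setminus\{u\})\cup\{v\}$ is out-dominating. $\gamma_{oso}(D)$ is the minimum size of an OSODS of $D$. -}

module Defs where

open import Data.Nat using (ℕ; _≤_)
open import Data.Bool using (Bool; true; false; _xor_)
open import Data.Fin using (Fin)
open import Data.Fin.Subset using (Subset; _∈_; _∉_; _∪_; _-_; ⁅_⁆; ∣_∣)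
open import Data.Product using (Σ; ∃; _×_)
open import Relation.Binary.PropositionalEquality using (_≡_; _≢_)

record SimpleGraph (n : ℕ) : Set where
  field
    adj   : Fin n → Fin n → Bool
    sym   : ∀ u v → adj u v ≡ adj v u
    irrefl : ∀ v → adj v v ≡ false
open SimpleGraph public

-- A digraph on Fin n: arc u v ≡ true means u → v is an arc.
Digraph : ℕ → Set
Digraph n = Fin n → Fin n → Bool

IsOrientation : ∀ {n} → SimpleGraph n → Digraph n → Set
IsOrientation {n} G D =
  (∀ u v → D u v ≡ true → adj G u v ≡ true) ×
  (∀ u v → adj G u v ≡ true → (D u v xor D v u) ≡ true)

OutDominating : ∀ {n} → Digraph n → Subset n → Set
OutDominating {n} D S =
  ∀ (v : Fin n) → v ∉ S → ∃ λ (u : Fin n) → u ∈ S × D u v ≡ true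

IsOSODS : ∀ {n} → Digraph n → Subset n → Set
IsOSODS {n} D S =
  OutDominating D S ×
  (∀ (v : Fin n) → v ∉ S →
     ∃ λ (u : Fin n) → u ∈ S × D u v ≡ true ×
       OutDominating D ((S - u) ∪ ⁅ v ⁆))

γoso≡ : ∀ {n} → Digraph n → ℕ → Set
γoso≡ {n} D k =
  (∃ λ (S : Subset n) → IsOSODS D S × ∣ S ∣ ≡ k) ×
  (∀ (S : Subset n) → IsOSODS D S → k ≤ ∣ S ∣)

IsBipartite : ∀ {n} → SimpleGraph n → Set
IsBipartite {n} G =
  ∃ λ (c : Fin n → Bool) → ∀ u v → adj G u v ≡ true → c u ≢ c v

-- Swapping u ∈ S for an out-neighbour v ∉ S leaves u needing an in-neighbour.
-- So if D has a path w → u → v, all vertices but v form an OSODS of size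
-- n − 1; if D has no directed path of length two, every such swap leaves u
-- undominated and only the full vertex set is an OSODS.  Hence γ_oso(D) = n
-- exactly when every vertex is a source or a sink, and such orientations of G
-- correspond to 2-colourings (colour a vertex by whether it is a source).
module Submission where

open import Defs hiding (sym)
open import Data.Bool using (Bool; true; false; _∧_; _xor_)
open import Data.Bool.Properties as Bool using (∧-conicalˡ)
open import Data.Empty using (⊥; ⊥-elim)
open import Data.Fin using (Fin; _≟_)
open import Data.Fin.Properties using (any?)
open import Data.Fin.Subset using (Subset; _∈_; _∉_; _∪_; _-_; _─_; ⁅_⁆; ∣_∣; ⊤; inside; outside)
open import Data.Fin.Subset.Properties
open import Data.Nat using (ℕ; _≤_; _<_)
open import Data.Nat.Properties using (<⇒≱)
open import Data.Product using (∃; _×_; _,_)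
open import Data.Sum using (inj₁; inj₂)
open import Data.Vec using (_∷_; here; there)
open import Function.Bundles using (_⇔_; mk⇔; Equivalence)
open import Relation.Nullary using (¬_; yes; no; does)
open import Relation.Binary.PropositionalEquality using (_≡_; _≢_; refl; sym; trans; subst)

private
  variable
    n : ℕ
    D : Digraph n
    S : Subset n
    u v w : Fin n

Loopless : Digraph n → Set
Loopless D = ∀ {u v} → D u v ≡ true → u ≢ v

Path₂Free : Digraph n → Set
Path₂Free D = ∀ {u v w} → D u v ≡ true → D v w ≡ true → ⊥

AllBut : Subset n → Fin n → Set
AllBut S v = ∀ {x} → x ≢ v → x ∈ S

x∈p─q⇒x∉q : ∀ {x : Fin n} (p q : Subset n) → x ∈ p ─ q → x ∉ q
x∈p─q⇒x∉q (inside ∷ p) (outside ∷ q) here ()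
x∈p─q⇒x∉q (_ ∷ p) (_ ∷ q) (there x∈p─q) (there x∈q) = x∈p─q⇒x∉q p q x∈p─q x∈q

x∉p-x : (p : Subset n) (x : Fin n) → x ∉ p - x
x∉p-x p x x∈p-x = x∈p─q⇒x∉q p ⁅ x ⁆ x∈p-x (x∈⁅x⁆ x)

x≢y⇒x∉p-x∪⁅y⁆ : (p : Subset n) {x y : Fin n} → x ≢ y → x ∉ (p - x) ∪ ⁅ y ⁆
x≢y⇒x∉p-x∪⁅y⁆ p {x} {y} x≢y x∈p-x∪⁅y⁆ with x∈p∪q⁻ (p - x) ⁅ y ⁆ x∈p-x∪⁅y⁆
... | inj₁ x∈p-x = x∉p-x p x x∈p-x
... | inj₂ x∈⁅y⁆ = x≢y (x∈⁅y⁆⇒x≡y y x∈⁅y⁆)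

allBut-∉⇒≡ : AllBut S v → w ∉ S → w ≡ v
allBut-∉⇒≡ {v = v} {w = w} allBut w∉S with w ≟ v
... | yes w≡v = w≡v
... | no  w≢v = ⊥-elim (w∉S (allBut w≢v))

allBut-⊤-x : (x : Fin n) → AllBut (⊤ - x) x
allBut-⊤-x x = x∈p∧x≢y⇒x∈p-y ∈⊤

allBut-swap : AllBut S v → AllBut ((S - u) ∪ ⁅ v ⁆) u
allBut-swap {v = v} allBut {x} x≢u with x ≟ v
... | yes refl = q⊆p∪q _ _ (x∈⁅x⁆ x)
... | no  x≢v  = p⊆p∪q _ (x∈p∧x≢y⇒x∈p-y (allBut x≢v) x≢u)

allBut⇒outDominating : AllBut S v → u ∈ S → D u v ≡ true → OutDominating D S
allBut⇒outDominating allBut u∈S uv x x∉S with allBut-∉⇒≡ allBut x∉S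
... | refl = _ , u∈S , uv

allIn⇒n≤∣p∣ : (p : Subset n) → (∀ x → x ∈ p) → n ≤ ∣ p ∣
allIn⇒n≤∣p∣ {n} p allIn = subst (_≤ ∣ p ∣) (∣⊤∣≡n n) (p⊆q⇒∣p∣≤∣q∣ {p = ⊤} (λ {x} _ → allIn x))

⊤-isOSODS : (D : Digraph n) → IsOSODS D ⊤
⊤-isOSODS D = (λ _ x∉⊤ → ⊥-elim (x∉⊤ ∈⊤)) , (λ _ x∉⊤ → ⊥-elim (x∉⊤ ∈⊤))

path₂⇒⊤-x-isOSODS : Loopless D → D w u ≡ true → D u v ≡ true → IsOSODS D (⊤ - v)
path₂⇒⊤-x-isOSODS {D = D} {u = u} {v = v} loopless wu uv =
  allBut⇒outDominating (allBut-⊤-x v) u∈⊤-v uv , secure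
  where
  u∈⊤-v : u ∈ ⊤ - v
  u∈⊤-v = allBut-⊤-x v (loopless uv)

  secure : ∀ x → x ∉ ⊤ - v → ∃ λ u' → u' ∈ ⊤ - v × D u' x ≡ true ×
                                       OutDominating D ((⊤ - v - u') ∪ ⁅ x ⁆)
  secure x x∉⊤-v with allBut-∉⇒≡ (allBut-⊤-x v) x∉⊤-v
  ... | refl = u , u∈⊤-v , uv ,
               allBut⇒outDominating swapped (swapped (loopless wu)) wu
    where
    swapped : AllBut ((⊤ - v - u) ∪ ⁅ v ⁆) u
    swapped = allBut-swap (allBut-⊤-x v)

swap-undominated : Loopless D → Path₂Free D → D u v ≡ true →
                   ¬ OutDominating D ((S - u) ∪ ⁅ v ⁆)
swap-undominated {u = u} {S = S} loopless path₂Free uv dominating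
  with dominating u (x≢y⇒x∉p-x∪⁅y⁆ S (loopless uv))
... | _ , _ , wu = path₂Free wu uv

path₂Free⇒osods-full : Loopless D → Path₂Free D → IsOSODS D S → ∀ x → x ∈ S
path₂Free⇒osods-full {S = S} loopless path₂Free (_ , secure) x with x ∈? S
... | yes x∈S = x∈S
... | no  x∉S with secure x x∉S
... | _ , _ , ux , dominating = ⊥-elim (swap-undominated loopless path₂Free ux dominating)

γoso≡n⇔path₂Free : {D : Digraph n} → Loopless D → γoso≡ D n ⇔ Path₂Free D
γoso≡n⇔path₂Free {n = n} {D = D} loopless = mk⇔ minimal⇒path₂Free path₂Free⇒minimal
  where
  minimal⇒path₂Free : γoso≡ D n → Path₂Free D
  minimal⇒path₂Free (_ , n≤osods) {w = w} uv vw =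
    <⇒≱ ∣⊤-w∣<n (n≤osods (⊤ - w) (path₂⇒⊤-x-isOSODS loopless uv vw))
    where
    ∣⊤-w∣<n : ∣ ⊤ - w ∣ < n
    ∣⊤-w∣<n = subst (∣ ⊤ - w ∣ <_) (∣⊤∣≡n n) (x∈p⇒∣p-x∣<∣p∣ {p = ⊤ {n}} ∈⊤)

  path₂Free⇒minimal : Path₂Free D → γoso≡ D n
  path₂Free⇒minimal path₂Free =
    (⊤ , ⊤-isOSODS D , ∣⊤∣≡n n) ,
    λ S osods → allIn⇒n≤∣p∣ S (path₂Free⇒osods-full loopless path₂Free osods)

orientation⇒loopless : (G : SimpleGraph n) → IsOrientation G D → Loopless D
orientation⇒loopless G (arc⇒edge , _) {u} uu refl with trans (sym (irrefl G u)) (arc⇒edge u u uu)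
... | ()

bipartite⇒path₂Free-orientation : (G : SimpleGraph n) → IsBipartite G →
  ∃ λ D → IsOrientation G D × Path₂Free D
bipartite⇒path₂Free-orientation G (c , proper) = trueToFalse , (arc⇒edge , edge⇒arc) , path₂Free
  where
  trueToFalse : Digraph _
  trueToFalse u v = c u ∧ adj G u v

  arc⇒edge : ∀ u v → trueToFalse u v ≡ true → adj G u v ≡ true
  arc⇒edge u v uv with c u
  ... | true = uv

  edge⇒arc : ∀ u v → adj G u v ≡ true → (trueToFalse u v xor trueToFalse v u) ≡ true
  edge⇒arc u v uv with c u | c v | proper u v uv
  ... | true  | true  | cu≢cv = ⊥-elim (cu≢cv refl)
  ... | false | false | cu≢cv = ⊥-elim (cu≢cv refl)
  ... | true  | false | _ rewrite uv = refl
  ... | false | true  | _ rewrite trans (SimpleGraph.sym G v u) uv = refl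

  path₂Free : Path₂Free trueToFalse
  path₂Free {u} {v} uv vw =
    proper u v (arc⇒edge u v uv) (trans (∧-conicalˡ _ _ uv) (sym (∧-conicalˡ _ _ vw)))

path₂Free-orientation⇒bipartite : (G : SimpleGraph n) → IsOrientation G D → Path₂Free D →
  IsBipartite G
path₂Free-orientation⇒bipartite {D = D} G (_ , edge⇒arc) path₂Free = isSource , proper
  where
  isSource : Fin _ → Bool
  isSource u = does (any? λ v → D u v Bool.≟ true)

  tail-isSource : D u v ≡ true → isSource u ≡ true
  tail-isSource {u} {v} uv with any? (λ v → D u v Bool.≟ true)
  ... | yes _ = refl
  ... | no ¬out = ⊥-elim (¬out (v , uv))

  head-notSource : D u v ≡ true → isSource v ≡ false
  head-notSource {v = v} uv with any? (λ w → D v w Bool.≟ true)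
  ... | yes (_ , vw) = ⊥-elim (path₂Free uv vw)
  ... | no _ = refl

  proper : ∀ u v → adj G u v ≡ true → isSource u ≢ isSource v
  proper u v uv same with D u v in arc | D v u in arc′ | edge⇒arc u v uv
  ... | true  | _    | _ with () ← trans (sym (tail-isSource arc)) (trans same (head-notSource arc))
  ... | false | true | _ with () ← trans (sym (head-notSource arc′)) (trans same (tail-isSource arc′))
  ... | false | false | ()

corollary2p6 : (n : ℕ) → 2 ≤ n → (G : SimpleGraph n) →
    (∃ λ (D : Digraph n) → IsOrientation G D × γoso≡ D n) ⇔ IsBipartite G
corollary2p6 n _ G = mk⇔ orientation⇒bipartite bipartite⇒orientation
  where
  characterisation : {D : Digraph n} → IsOrientation G D → γoso≡ D n ⇔ Path₂Free D
  characterisation orientation = γoso≡n⇔path₂Free (orientation⇒loopless G orientation)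

  orientation⇒bipartite : (∃ λ D → IsOrientation G D × γoso≡ D n) → IsBipartite G
  orientation⇒bipartite (D , orientation , γ≡n) =
    path₂Free-orientation⇒bipartite G orientation (Equivalence.to (characterisation orientation) γ≡n)

  bipartite⇒orientation : IsBipartite G → ∃ λ D → IsOrientation G D × γoso≡ D n
  bipartite⇒orientation bipartite with bipartite⇒path₂Free-orientation G bipartite
  ... | D , orientation , path₂Free =
    D , orientation , Equivalence.from (characterisation orientation) path₂Free
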